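{- The statement "not every subobject of $\mathbb{N}$ is countable" is valid in $\mathsf{RT}(\mathcal{K}_2)$.
   Context: $\mathsf{RT}(\mathcal{K}_2)$ denotes the realizability topos built on Kleene's second partial combinatory algebra $\mathcal{K}_2$ (Kleene's function realizability), with intuitionistic internal language; $\mathbb{N}$ is its natural numbers object. Internally, a set $X$ is countable if there is a surjection $\mathbb{N}\twoheadrightarrow X+1$. -}

module Defs where

-- Realizability interpretation in RT(K₂) (Kleene's function realizability) of the
-- specific internal formula  ∀ A ∈ Ω^ℕ . Countable(A),  where
--   Countable(A) := ∃ f : ℕ → ℕ+1 . (∀ n . f n ∈ A+1) ∧ (∀ x ∈ ℕ+1 . x ∈ A+1 → ∃ n ∈ ℕ . f n = x)
-- (i.e. a surjection ℕ ↠ A+1, A+1 viewed as a subobject of ℕ+1).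

open import Data.Nat using (ℕ; zero; suc; _+_; _*_; _<_)
open import Data.List using (List; []; _∷_; _++_; [_])
open import Data.Maybe using (Maybe; nothing; just)
open import Data.Product using (Σ; _×_; _,_)
open import Data.Unit using (⊤)
open import Data.Empty using (⊥)
open import Relation.Binary.PropositionalEquality using (_≡_)

Baire : Set
Baire = ℕ → ℕ

-- Cantor pairing and coding of finite sequences (a bijection List ℕ ≅ ℕ)
tri : ℕ → ℕ
tri zero    = 0
tri (suc n) = suc n + tri n

pairℕ : ℕ → ℕ → ℕ
pairℕ a b = tri (a + b) + b

code : List ℕ → ℕ
code []       = 0
code (x ∷ xs) = suc (pairℕ x (code xs))

prefix : Baire → ℕ → List ℕ
prefix β zero    = []
prefix β (suc k) = prefix β k ++ [ β k ]

-- Partial application of K₂:  App α β γ  means  α·β ↓ and α·β = γ,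
-- i.e. for every n the first k with α(⟨n⟩*β̄k) > 0 exists and α(⟨n⟩*β̄k) = γ n + 1.
App : Baire → Baire → Baire → Set
App α β γ = ∀ n → Σ ℕ λ k →
  (∀ j → j < k → α (code (n ∷ prefix β j)) ≡ 0) × (α (code (n ∷ prefix β k)) ≡ suc (γ n))

π₁ π₂ : Baire → Baire
π₁ δ n = δ (2 * n)
π₂ δ n = δ (suc (2 * n))

-- realizers of natural numbers (ℕ in RT(K₂)): n is realized by the constant sequence
const : ℕ → Baire
const n _ = n

-- realizers of ℕ+1 (≅ ℕ, modest): nothing ↦ const 0, just m ↦ const (m+1)
codeM : Maybe ℕ → ℕ
codeM nothing  = 0
codeM (just m) = suc m

-- subobjects of ℕ: predicates ℕ → P(K₂)
Pred : Set₁
Pred = ℕ → Baire → Set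

InA+1 : Pred → Maybe ℕ → Baire → Set
InA+1 A nothing  ρ = ⊤
InA+1 A (just m) ρ = A m ρ

-- realizers of  ∃ n ∈ ℕ . g n = x   (equality on ℕ+1 realized by anything when true)
RExN : (ℕ → Maybe ℕ) → Maybe ℕ → Baire → Set
RExN g x δ = Σ ℕ λ n → (∀ i → π₁ δ i ≡ n) × (g n ≡ x)

-- realizers of  ∀ n . g n ∈ A+1
RTotal : Pred → (ℕ → Maybe ℕ) → Baire → Set
RTotal A g β = ∀ n → Σ Baire λ δ → App β (const n) δ × InA+1 A (g n) δ

-- realizers of  ∀ x ∈ ℕ+1 . x ∈ A+1 → ∃ n . g n = x
RSurj : Pred → (ℕ → Maybe ℕ) → Baire → Set
RSurj A g β = ∀ x → Σ Baire λ γ → App β (const (codeM x)) γ ×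
  (∀ ρ → InA+1 A x ρ → Σ Baire λ δ → App γ ρ δ × RExN g x δ)

-- realizers of  Countable(A):  ∃ g ∈ (ℕ+1)^ℕ . (∀ n . g n ∈ A+1) ∧ surjectivity
-- (α tracks g: α·n̂ = realizer of g n)
RCountable : Pred → Baire → Set
RCountable A e = Σ (ℕ → Maybe ℕ) λ g →
  (∀ n → App (π₁ e) (const n) (const (codeM (g n))))
  × (RTotal A g (π₁ (π₂ e)) × RSurj A g (π₂ (π₂ e)))

-- realizers of  ∀ A ∈ Ω^ℕ . Countable(A)   (every element of Baire realizes existence of A)
RAllCountable : Baire → Set₁
RAllCountable a = ∀ (A : Pred) (α : Baire) → Σ Baire λ γ → App a α γ × RCountable A γ

-- the statement  ¬ ∀ A ∈ Ω^ℕ . Countable(A)  is valid in RT(K₂): it has a realizer r,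
-- i.e. for every realizer a of the antecedent, r·a ↓ and realizes ⊥ (which has no realizers)
ValidNotAllCountable : Set₁
ValidNotAllCountable = Σ Baire λ r → ∀ a → RAllCountable a → Σ Baire λ γ → App r a γ × ⊥

module Submission where

-- In RT(K₂) a realizer of  ∀ A ∈ Ω^ℕ . Countable(A)  is a single
-- element a of Baire space that works uniformly for every subobject A of ℕ: applied to
-- a (trivial) realizer of A's existence it yields a realizer of Countable(A).  Since K₂
-- application is deterministic, the result a·α does not depend on A, and neither does
-- the enumeration g : ℕ → ℕ+1 it tracks, because ℕ+1 is modest (its realizers code
-- elements injectively).  Compare the empty subobject ∅ with the full subobject ℕ:
-- the enumeration of ℕ+1 must hit  just 0  at some index n, while every value of an
-- enumeration of ∅+1 must lie in ∅+1, i.e. be  nothing.  The shared enumeration gives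
-- a contradiction, so the antecedent has no realizers and any element of Baire space
-- realizes the negation.

open import Defs
open import Data.Nat using (ℕ; pred)
open import Data.Nat.Properties using (<-cmp)
open import Data.Maybe using (nothing; just)
open import Data.Product using (Σ; _,_; proj₁)
open import Data.Unit using (⊤; tt)
open import Data.Empty using (⊥; ⊥-elim)
open import Relation.Binary using (tri<; tri≈; tri>)
open import Relation.Binary.PropositionalEquality using (_≡_; _≗_; refl; sym; trans; cong; module ≡-Reasoning)
open ≡-Reasoning

-- Application in K₂ is deterministic, and extensional in the function argument:
-- the first k with α(⟨n⟩*β̄k) > 0 is unique, hence so is the output value.
App-deterministic : ∀ {α α′ β γ γ′} → α ≗ α′ → App α β γ → App α′ β γ′ → γ ≗ γ′
App-deterministic α≗α′ p q n with p n | q n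
... | k , below , at | k′ , below′ , at′ with <-cmp k k′
... | tri< k<k′ _ _ with () ← trans (sym at) (trans (α≗α′ _) (below′ k k<k′))
... | tri> _ _ k′<k with () ← trans (sym at′) (trans (sym (α≗α′ _)) (below k′ k′<k))
... | tri≈ _ refl _ = cong pred (trans (sym at) (trans (α≗α′ _) at′))

codeM-injective : ∀ {x y} → codeM x ≡ codeM y → x ≡ y
codeM-injective {nothing} {nothing} _    = refl
codeM-injective {just _}  {just _}  refl = refl

enumeration-determined : ∀ {A B} {e e′ : Baire} → e ≗ e′ →
  (cA : RCountable A e) (cB : RCountable B e′) → proj₁ cA ≗ proj₁ cB
enumeration-determined {e = e} {e′} e≗e′ (g , trackA , _) (g′ , trackB , _) n =
  codeM-injective
    (App-deterministic {π₁ e} {π₁ e′} {const n} (λ i → e≗e′ _) (trackA n) (trackB n) 0)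

∅ Full : Pred
∅    _ _ = ⊥
Full _ _ = ⊤

enumeration-of-∅ : ∀ {e} (c : RCountable ∅ e) → ∀ n → proj₁ c n ≡ nothing
enumeration-of-∅ (g , _ , total , _) n with g n | total n
... | nothing | _ = refl
... | just _  | _ , _ , ()

enumeration-of-Full : ∀ {e} (c : RCountable Full e) → Σ ℕ λ n → proj₁ c n ≡ just 0
enumeration-of-Full (g , _ , _ , surj) with surj (just 0)
... | _ , _ , onto with onto (const 0) tt
... | _ , _ , n , _ , gn≡just0 = n , gn≡just0

not-all-countable : ∀ a → RAllCountable a → ⊥
not-all-countable a realizes with realizes ∅ (const 0) | realizes Full (const 0)
... | e , a·α≡e , c∅ | e′ , a·α≡e′ , cFull with enumeration-of-Full {e′} cFull
... | n , hits-just0 with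
  (begin
    nothing           ≡⟨ sym (enumeration-of-∅ {e} c∅ n) ⟩
    proj₁ c∅ n        ≡⟨ enumeration-determined {∅} {Full} {e} {e′} same-result c∅ cFull n ⟩
    proj₁ cFull n     ≡⟨ hits-just0 ⟩
    just 0            ∎)
  where
  same-result : e ≗ e′
  same-result = App-deterministic {a} {a} {const 0} (λ _ → refl) a·α≡e a·α≡e′
... | ()

corollary2p7 : ValidNotAllCountable
corollary2p7 = const 0 , λ a realizes → ⊥-elim (not-all-countable a realizes)
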